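{- Let $k\ge1$ and let $r_k(n)=\mathrm{mp}_C(n,k)$ for $n\ge1$, with $r_k(0)=1$. Then for all $n\ge0$, \[ r_k(n+1)=\sum_{\substack{0\le j\le n\\ k\mid j}} r_k(j)\,r_k(n-j). \]
   Context: A subexcedant function on $[n]$ is a map $f:[n]\to[n]$ with $1\le f(i)\le i$. For such $f$ let $\varphi(f) = (n\ f(n)) \circ \dots \circ (2\ f(2)) \circ (1\ f(1))$, where $(a\ b)$ is the transposition swapping $a,b$ (identity if $a=b$) and $\circ$ is composition; $\varphi$ is a bijection onto permutations of $[n]$, and $f_\pi:=\varphi^{ -1}(\pi)$. A word $w_1\cdots w_n$ is a Catalan word if $w_1=1$ and $1\le w_i\le w_{i-1}+1$ for $2\le i\le n$. A permutation $\pi$ of $[n]$ is mod-$k$-alternating if $\pi(i)\equiv i\pmod k$ for all $i$. $\mathrm{mp}_C(n,k)$ is the number of mod-$k$-alternating permutations $\pi$ of $[n]$ with $f_\pi(1)\cdots f_\pi(n)$ a Catalan word. -}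

module Defs where

open import Data.Nat using (ℕ; zero; suc; _+_; _*_; _∸_; _≡ᵇ_; _≤ᵇ_; _%_; NonZero)
open import Data.Bool using (Bool; true; false; _∧_; _∨_; if_then_else_; not)
open import Data.List using (List; []; _∷_; _++_; map; concatMap; foldl; zip; length; filterᵇ; upTo)
open import Data.Bool.ListAction using (all; any)
open import Data.Nat.ListAction using (sum)
open import Data.Product using (_,_)
open import Data.Nat.Divisibility using (_∣?_)
open import Relation.Nullary.Decidable using (⌊_⌋)

-- Conventions: a map g : [n] → [n] is represented by the word [g(1), …, g(n)]
-- (values are 1-based natural numbers).

range1 : ℕ → List ℕ
range1 n = map suc (upTo n)

words : ℕ → ℕ → List (List ℕ)
words m zero = [] ∷ []
words m (suc len) = concatMap (λ w → map (λ v → v ∷ w) (range1 m)) (words m len)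

eqWord : List ℕ → List ℕ → Bool
eqWord [] [] = true
eqWord (x ∷ xs) (y ∷ ys) = (x ≡ᵇ y) ∧ eqWord xs ys
eqWord _ _ = false

elemᵇ : ℕ → List ℕ → Bool
elemᵇ v w = any (λ x → x ≡ᵇ v) w

isPermOf : ℕ → List ℕ → Bool
isPermOf n w = all (λ v → elemᵇ v w) (range1 n)

perms : ℕ → List (List ℕ)
perms n = filterᵇ (isPermOf n) (words n n)

subex : ℕ → List (List ℕ)
subex zero = [] ∷ []
subex (suc n) = concatMap (λ w → map (λ v → w ++ (v ∷ [])) (range1 (suc n))) (subex n)

swap : ℕ → ℕ → ℕ → ℕ
swap a b x = if x ≡ᵇ a then b else (if x ≡ᵇ b then a else x)

-- φ(f) = (n f(n)) ∘ … ∘ (2 f(2)) ∘ (1 f(1)) evaluated at x: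
-- (1 f(1)) is applied first, (n f(n)) last.
phiAt : List ℕ → ℕ → ℕ
phiAt f x = foldl (λ acc p → swapPair p acc) x (zip (range1 (length f)) f)
  where
  swapPair : _ → ℕ → ℕ
  swapPair (a , b) y = swap a b y

phi : List ℕ → List ℕ
phi f = map (phiAt f) (range1 (length f))

catalanTail : ℕ → List ℕ → Bool
catalanTail prev [] = true
catalanTail prev (x ∷ xs) = (1 ≤ᵇ x) ∧ (x ≤ᵇ suc prev) ∧ catalanTail x xs

isCatalan : List ℕ → Bool
isCatalan [] = true
isCatalan (x ∷ xs) = (x ≡ᵇ 1) ∧ catalanTail x xs

-- f_π Catalan: the (unique, φ being a bijection) subexcedant f with φ(f) = π
-- is a Catalan word
fCatalan : ℕ → List ℕ → Bool
fCatalan n π = any (λ f → eqWord (phi f) π ∧ isCatalan f) (subex n)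

modAltAux : (k : ℕ) → .{{NonZero k}} → ℕ → List ℕ → Bool
modAltAux k i [] = true
modAltAux k i (x ∷ xs) = ((x % k) ≡ᵇ (i % k)) ∧ modAltAux k (suc i) xs

isModAlt : (k : ℕ) → .{{NonZero k}} → List ℕ → Bool
isModAlt k π = modAltAux k 1 π

mpC : ℕ → (k : ℕ) → .{{NonZero k}} → ℕ
mpC n k = length (filterᵇ (λ π → isModAlt k π ∧ fCatalan n π) (perms n))

r : (k : ℕ) → .{{NonZero k}} → ℕ → ℕ
r k zero = 1
r k (suc n) = mpC (suc n) k

convSum : (k : ℕ) → .{{NonZero k}} → ℕ → ℕ
convSum k n = sum (map (λ j → r k j * r k (n ∸ j)) (filterᵇ (λ j → ⌊ k ∣? j ⌋) (upTo (suc n))))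

module Submission where

-- φ(f₁⋯fₙv) = (n+1 v) ∘ φ(f₁⋯fₙ), and φ(f₁⋯fₙ) fixes n+1, so φ(f₁⋯fₙv) sends n+1 to v, and
-- the new transposition preserves residues mod k exactly when v ≡ n+1 (mod k). By induction φ(f)
-- is mod-k-alternating iff f is, so φ, a bijection onto permutations, identifies r_k(n) with the
-- number of Catalan words f of length n with f(i) ≡ i (mod k).
-- Such a word of length n+1 splits uniquely at its last letter 1 as A · 1 · (B + 1) with A, B
-- Catalan. The 1 at position |A| + 1 forces k ∣ |A|; then the letters of B + 1, shifted by 1 in
-- value and by |A| + 1 in position, satisfy the condition iff B does. Summing over j = |A| gives
-- the recurrence. Both counts compare duplicate-free lists with the same members, which are
-- permutations of each other.

open import Defs
open import Data.Nat using (ℕ; suc; NonZero)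
open import Relation.Binary.PropositionalEquality using (_≡_)

open import Data.Nat.Base using (zero; _+_; _*_; _∸_; _≤_; _<_; z≤n; s≤s; _≡ᵇ_; _≤ᵇ_; _%_)
open import Data.Nat.Properties
  using (_≟_; suc-injective; ≡ᵇ⇒≡; ≡⇒≡ᵇ; ≤ᵇ⇒≤; +-identityʳ; +-comm; +-suc; ≤-trans; ≤-pred; n≤1+n;
         n<1+n; <⇒≢; m≤m+n; m+n∸m≡n; m+[n∸m]≡n)
open import Data.Nat.Divisibility using (_∣_; _∣?_; _∣0; m%n≡0⇒n∣m; n∣m⇒m%n≡0)
open import Data.Nat.DivMod using (%-distribˡ-+; [m+n]%n≡m%n; %-remove-+ʳ)
open import Data.Nat.ListAction using (sum)
open import Data.Bool using (Bool; true; false; _∧_; T)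
open import Data.Bool.Properties using (T-∧; ∧-assoc; ∧-comm; ∧-identityʳ; ∧-commutativeMonoid)
open import Algebra.Bundles using (CommutativeMonoid)
open import Algebra.Properties.CommutativeSemigroup
  (CommutativeMonoid.commutativeSemigroup ∧-commutativeMonoid) using (interchange; x∙yz≈y∙xz)
open import Data.List
  using (List; []; _∷_; _++_; _∷ʳ_; [_]; map; concatMap; cartesianProductWith; cartesianProduct;
         foldl; zip; length; filterᵇ; upTo)
open import Data.List.Properties
  using (map-++; map-∘; map-cong; map-injective; length-map; length-++; length-++-sucʳ; length-upTo;
         upTo-∷ʳ; foldl-∷ʳ; ++-assoc; ++-identityʳ; ∷-injective; ∷ʳ-injective)
open import Data.List.Membership.Propositional using (_∈_; _∉_; find; lose)
open import Data.List.Membership.Propositional.Properties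
  using (∈-map⁺; ∈-map⁻; ∈-++⁺ˡ; ∈-++⁺ʳ; ∈-++⁻; ∈-insert; ∈-upTo⁺; ∈-upTo⁻; ∈-filter⁺; ∈-filter⁻;
         ∈-concatMap⁺; ∈-concatMap⁻; ∈-cartesianProductWith⁺; ∈-cartesianProductWith⁻;
         ∈-cartesianProduct⁺; ∈-cartesianProduct⁻)
open import Data.List.Membership.Propositional.Properties.WithK using (unique∧set⇒bag)
open import Data.List.Relation.Binary.BagAndSetEquality using (∼bag⇒↭)
open import Data.List.Relation.Binary.Permutation.Propositional.Properties using (↭-length)
open import Data.List.Relation.Unary.All as All using (All; []; _∷_)
import Data.List.Relation.Unary.All.Properties as All
open import Data.List.Relation.Unary.Any as Any using (here; there)
open import Data.List.Relation.Unary.Any.Properties using (any⁺; any⁻)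
open import Data.List.Relation.Unary.AllPairs using ([]; _∷_)
import Data.List.Relation.Unary.AllPairs as AllPairs
import Data.List.Relation.Unary.AllPairs.Properties as AllPairs
open import Data.List.Relation.Unary.Unique.Propositional using (Unique)
open import Data.List.Relation.Unary.Unique.Propositional.Properties
  using (upTo⁺; filter⁺; cartesianProductWith⁺; cartesianProduct⁺; concat⁺)
  renaming (map⁺ to unique-map⁺)
open import Data.Product using (_×_; _,_; ∃; proj₁; proj₂)
import Data.Product as Product
open import Data.Sum using (inj₁; inj₂)
open import Function using (_∘_; _⇔_; mk⇔; Equivalence)
open import Relation.Binary.PropositionalEquality
  using (_≢_; refl; sym; trans; cong; cong₂; subst; subst₂; module ≡-Reasoning)
open import Relation.Nullary using (yes; no; ¬_; contradiction)
open import Relation.Nullary.Decidable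
  using (T?; ⌊_⌋; dec-true; dec-false; does-⇔; isYes≗does; toWitness; fromWitness)

≡ᵇ-true : ∀ {m n} → m ≡ n → (m ≡ᵇ n) ≡ true
≡ᵇ-true {m} {n} = dec-true (m ≟ n)

≡ᵇ-false : ∀ {m n} → m ≢ n → (m ≡ᵇ n) ≡ false
≡ᵇ-false {m} {n} = dec-false (m ≟ n)

T-∧⁺ : ∀ {a b} → T a → T b → T (a ∧ b)
T-∧⁺ ta tb = Equivalence.from T-∧ (ta , tb)

T-∧⁻ : ∀ {a b} → T (a ∧ b) → T a × T b
T-∧⁻ = Equivalence.to T-∧

∧-congˡ-guarded : ∀ b {x y} → (T b → x ≡ y) → b ∧ x ≡ b ∧ y
∧-congˡ-guarded true  x≡y = x≡y _
∧-congˡ-guarded false x≡y = refl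

length-∷ʳ : ∀ {A : Set} (xs : List A) x → length (xs ∷ʳ x) ≡ suc (length xs)
length-∷ʳ xs x = trans (length-++ xs) (+-comm (length xs) 1)

zip-∷ʳ : ∀ {A B : Set} {xs : List A} {ys : List B} {a b} → length xs ≡ length ys →
         zip (xs ∷ʳ a) (ys ∷ʳ b) ≡ zip xs ys ∷ʳ (a , b)
zip-∷ʳ {xs = []}     {[]}     _ = refl
zip-∷ʳ {xs = x ∷ xs} {y ∷ ys} e = cong ((x , y) ∷_) (zip-∷ʳ (suc-injective e))

module _ {A B C : Set} where

  concatMap-map≡cartesianProductWith : (f : A → B → C) (xs : List A) (ys : List B) →
    concatMap (λ x → map (f x) ys) xs ≡ cartesianProductWith f xs ys
  concatMap-map≡cartesianProductWith f [] ys = refl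
  concatMap-map≡cartesianProductWith f (x ∷ xs) ys =
    cong (map (f x) ys ++_) (concatMap-map≡cartesianProductWith f xs ys)

module _ {A : Set} (p : A → Bool) where

  ∈-filterᵇ⁺ : ∀ {x xs} → x ∈ xs → T (p x) → x ∈ filterᵇ p xs
  ∈-filterᵇ⁺ = ∈-filter⁺ (T? ∘ p)

  ∈-filterᵇ⁻ : ∀ {x xs} → x ∈ filterᵇ p xs → x ∈ xs × T (p x)
  ∈-filterᵇ⁻ = ∈-filter⁻ (T? ∘ p)

  filterᵇ-unique : ∀ {xs} → Unique xs → Unique (filterᵇ p xs)
  filterᵇ-unique = filter⁺ (T? ∘ p)

++-∷-cancel : ∀ {A : Set} {y : A} xs xs′ {zs zs′} → y ∉ zs → y ∉ zs′ →
              xs ++ y ∷ zs ≡ xs′ ++ y ∷ zs′ → xs ≡ xs′ × zs ≡ zs′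
++-∷-cancel []       []        _    _     e = refl , proj₂ (∷-injective e)
++-∷-cancel []       (_ ∷ xs′) y∉zs _     e =
  contradiction (subst (_ ∈_) (sym (proj₂ (∷-injective e))) (∈-insert xs′)) y∉zs
++-∷-cancel (_ ∷ xs) []        _    y∉zs′ e =
  contradiction (subst (_ ∈_) (proj₂ (∷-injective e)) (∈-insert xs)) y∉zs′
++-∷-cancel (x ∷ xs) (_ ∷ xs′) y∉zs y∉zs′ e with refl , e′ ← ∷-injective e =
  Product.map₁ (cong (x ∷_)) (++-∷-cancel xs xs′ y∉zs y∉zs′ e′)

module _ {A : Set} where

  length-unique-⇔ : {xs ys : List A} → Unique xs → Unique ys →
                    (∀ {x} → x ∈ xs ⇔ x ∈ ys) → length xs ≡ length ys
  length-unique-⇔ u v xs⇔ys = ↭-length (∼bag⇒↭ (unique∧set⇒bag u v xs⇔ys))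

module _ {A B : Set} where

  map⁺-injectiveOn : {f : A → B} {xs : List A} →
                     (∀ {x y} → x ∈ xs → y ∈ xs → f x ≡ f y → x ≡ y) →
                     Unique xs → Unique (map f xs)
  map⁺-injectiveOn inj [] = []
  map⁺-injectiveOn inj (x≢xs ∷ u) =
    All.map⁺ (All.tabulate λ y∈ fx≡fy → All.lookup x≢xs y∈ (inj (here refl) (there y∈) fx≡fy))
    ∷ map⁺-injectiveOn (λ x∈ y∈ → inj (there x∈) (there y∈)) u

  concatMap⁺-fibres : {f : B → List A} {ks : List B} (key : A → B) →
                      (∀ {j x} → x ∈ f j → key x ≡ j) →
                      (∀ j → Unique (f j)) → Unique ks → Unique (concatMap f ks)
  concatMap⁺-fibres {f} key fibre unique-f unique-ks =
    concat⁺ (All.map⁺ (All.tabulate λ {j} _ → unique-f j))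
            (AllPairs.map⁺ (AllPairs.map disjoint unique-ks))
    where
    disjoint : ∀ {i j} → i ≢ j → ∀ {x} → ¬ (x ∈ f i × x ∈ f j)
    disjoint i≢j (x∈fi , x∈fj) = i≢j (trans (sym (fibre x∈fi)) (fibre x∈fj))

  length-concatMap : (f : A → List B) (xs : List A) →
                     length (concatMap f xs) ≡ sum (map (length ∘ f) xs)
  length-concatMap f [] = refl
  length-concatMap f (x ∷ xs) =
    trans (length-++ (f x)) (cong (length (f x) +_) (length-concatMap f xs))

  length-cartesianProduct : (xs : List A) (ys : List B) →
                            length (cartesianProduct xs ys) ≡ length xs * length ys
  length-cartesianProduct [] ys = refl
  length-cartesianProduct (x ∷ xs) ys =
    trans (length-++ (map (x ,_) ys)) (cong₂ _+_ (length-map (x ,_) ys) (length-cartesianProduct xs ys))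

-- Transpositions

module _ (a b : ℕ) where

  swap-≡ˡ : swap a b a ≡ b
  swap-≡ˡ rewrite ≡ᵇ-true {a} refl = refl

  swap-≡ʳ : swap a b b ≡ a
  swap-≡ʳ with b ≟ a
  ... | yes refl = swap-≡ˡ
  ... | no b≢a rewrite ≡ᵇ-false b≢a | ≡ᵇ-true {b} refl = refl

  swap-fix : ∀ {x} → x ≢ a → x ≢ b → swap a b x ≡ x
  swap-fix x≢a x≢b rewrite ≡ᵇ-false x≢a | ≡ᵇ-false x≢b = refl

  swap-involutive : ∀ x → swap a b (swap a b x) ≡ x
  swap-involutive x with x ≟ a | x ≟ b
  ... | yes refl | _        = trans (cong (swap a b) swap-≡ˡ) swap-≡ʳ
  ... | no _     | yes refl = trans (cong (swap a b) swap-≡ʳ) swap-≡ˡ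
  ... | no x≢a   | no x≢b   = trans (cong (swap a b) (swap-fix x≢a x≢b)) (swap-fix x≢a x≢b)

  swap-injective : ∀ {x y} → swap a b x ≡ swap a b y → x ≡ y
  swap-injective {x} {y} e =
    trans (sym (swap-involutive x)) (trans (cong (swap a b) e) (swap-involutive y))

  swap-preserves : (P : ℕ → Set) → P a → P b → ∀ {x} → P x → P (swap a b x)
  swap-preserves P pa pb {x} px with x ≟ a | x ≟ b
  ... | yes refl | _        = subst P (sym swap-≡ˡ) pb
  ... | no _     | yes refl = subst P (sym swap-≡ʳ) pa
  ... | no x≢a   | no x≢b   = subst P (sym (swap-fix x≢a x≢b)) px

  swap-% : ∀ k .{{_ : NonZero k}} → a % k ≡ b % k → ∀ x → swap a b x % k ≡ x % k
  swap-% k a≡b x with x ≟ a | x ≟ b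
  ... | yes refl | _        = trans (cong (_% k) swap-≡ˡ) (sym a≡b)
  ... | no _     | yes refl = trans (cong (_% k) swap-≡ʳ) a≡b
  ... | no x≢a   | no x≢b   = cong (_% k) (swap-fix x≢a x≢b)

-- Subexcedant words

range1-suc : ∀ n → range1 (suc n) ≡ range1 n ∷ʳ suc n
range1-suc n = trans (cong (map suc) (sym (upTo-∷ʳ n))) (map-++ suc (upTo n) [ n ])

length-range1 : ∀ n → length (range1 n) ≡ n
length-range1 n = trans (length-map suc (upTo n)) (length-upTo n)

range1-unique : ∀ n → Unique (range1 n)
range1-unique n = unique-map⁺ suc-injective (upTo⁺ n)

∈-range1⁺ : ∀ {x n} → 1 ≤ x → x ≤ n → x ∈ range1 n
∈-range1⁺ {suc x} _ x<n = ∈-map⁺ suc (∈-upTo⁺ x<n)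

∈-range1⁻ : ∀ {x n} → x ∈ range1 n → x ≤ n
∈-range1⁻ x∈ with _ , i∈ , refl ← ∈-map⁻ suc x∈ = ∈-upTo⁻ i∈

∈-range1-suc⁺ : ∀ {x n} → x ∈ range1 n → x ∈ range1 (suc n)
∈-range1-suc⁺ {n = n} x∈ = subst (_ ∈_) (sym (range1-suc n)) (∈-++⁺ˡ x∈)

top∈range1 : ∀ n → suc n ∈ range1 (suc n)
top∈range1 n = subst (suc n ∈_) (sym (range1-suc n)) (∈-++⁺ʳ (range1 n) (here refl))

∈-range1-suc⁻ : ∀ {x n} → x ∈ range1 (suc n) → x ≢ suc n → x ∈ range1 n
∈-range1-suc⁻ {n = n} x∈ x≢top with ∈-++⁻ (range1 n) (subst (_ ∈_) (range1-suc n) x∈)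
... | inj₁ x∈range1 = x∈range1
... | inj₂ (here x≡top) = contradiction x≡top x≢top

data Subexcedant : ℕ → List ℕ → Set where
  []   : Subexcedant 0 []
  snoc : ∀ {n w v} → Subexcedant n w → v ∈ range1 (suc n) → Subexcedant (suc n) (w ∷ʳ v)

Subexcedant-length : ∀ {n w} → Subexcedant n w → length w ≡ n
Subexcedant-length [] = refl
Subexcedant-length (snoc {w = w} {v} sw _) = trans (length-∷ʳ w v) (cong suc (Subexcedant-length sw))

subex-suc : ∀ n → subex (suc n) ≡ cartesianProductWith _∷ʳ_ (subex n) (range1 (suc n))
subex-suc n = concatMap-map≡cartesianProductWith _∷ʳ_ (subex n) (range1 (suc n))

∈-subex⁺ : ∀ {n w} → Subexcedant n w → w ∈ subex n
∈-subex⁺ [] = here refl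
∈-subex⁺ {suc n} (snoc sw v∈) =
  subst (_ ∈_) (sym (subex-suc n)) (∈-cartesianProductWith⁺ _∷ʳ_ (∈-subex⁺ sw) v∈)

∈-subex⁻ : ∀ n {w} → w ∈ subex n → Subexcedant n w
∈-subex⁻ zero (here refl) = []
∈-subex⁻ (suc n) w∈
  with _ , _ , w′∈ , v∈ , refl ← ∈-cartesianProductWith⁻ _∷ʳ_ (subex n) _ (subst (_ ∈_) (subex-suc n) w∈)
  = snoc (∈-subex⁻ n w′∈) v∈

subex-unique : ∀ n → Unique (subex n)
subex-unique zero = [] ∷ []
subex-unique (suc n) =
  subst Unique (sym (subex-suc n))
    (cartesianProductWith⁺ _∷ʳ_ (∷ʳ-injective _ _) (subex-unique n) (range1-unique (suc n)))

words-suc : ∀ m len → words m (suc len) ≡ cartesianProductWith (λ w v → v ∷ w) (words m len) (range1 m)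
words-suc m len = concatMap-map≡cartesianProductWith (λ w v → v ∷ w) (words m len) (range1 m)

∈-words⁺ : ∀ {m w} → All (_∈ range1 m) w → w ∈ words m (length w)
∈-words⁺ [] = here refl
∈-words⁺ {m} {v ∷ w} (v∈ ∷ w∈) =
  subst (_ ∈_) (sym (words-suc m (length w))) (∈-cartesianProductWith⁺ (λ w v → v ∷ w) (∈-words⁺ w∈) v∈)

words-unique : ∀ m len → Unique (words m len)
words-unique m zero = [] ∷ []
words-unique m (suc len) =
  subst Unique (sym (words-suc m len))
    (cartesianProductWith⁺ _ (Product.swap ∘ ∷-injective) (words-unique m len) (range1-unique m))

-- The map φ

-- Stated for an arbitrary step c because the step function of phiAt is local to Defs.
foldl-zip-range1-∷ʳ : ∀ {A : Set} (c : A → ℕ × ℕ → A) x w v →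
  foldl c x (zip (range1 (length (w ∷ʳ v))) (w ∷ʳ v)) ≡
  c (foldl c x (zip (range1 (length w)) w)) (suc (length w) , v)
foldl-zip-range1-∷ʳ c x w v = begin
  foldl c x (zip (range1 (length (w ∷ʳ v))) (w ∷ʳ v))
    ≡⟨ cong (λ r → foldl c x (zip r (w ∷ʳ v)))
            (trans (cong range1 (length-∷ʳ w v)) (range1-suc (length w))) ⟩
  foldl c x (zip (range1 (length w) ∷ʳ suc (length w)) (w ∷ʳ v))
    ≡⟨ cong (foldl c x) (zip-∷ʳ {xs = range1 (length w)} {w} (length-range1 (length w))) ⟩
  foldl c x (zip (range1 (length w)) w ∷ʳ (suc (length w) , v))
    ≡⟨ foldl-∷ʳ c x _ (zip (range1 (length w)) w) ⟩
  c (foldl c x (zip (range1 (length w)) w)) (suc (length w) , v) ∎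
  where open ≡-Reasoning

phiAt-snoc : ∀ {n w} v → Subexcedant n w → ∀ x → phiAt (w ∷ʳ v) x ≡ swap (suc n) v (phiAt w x)
phiAt-snoc {w = w} v sw x =
  trans (foldl-zip-range1-∷ʳ _ x w v) (cong (λ L → swap (suc L) v (phiAt w x)) (Subexcedant-length sw))

phiAt-fix : ∀ {n w x} → Subexcedant n w → n < x → phiAt w x ≡ x
phiAt-fix [] _ = refl
phiAt-fix {x = x} (snoc {n} {w} {v} sw v∈) 1+n<x =
  trans (phiAt-snoc v sw x)
        (trans (cong (swap (suc n) v) (phiAt-fix sw (≤-trans (n≤1+n (suc n)) 1+n<x)))
               (swap-fix (suc n) v (<⇒≢ 1+n<x ∘ sym) (<⇒≢ (≤-trans (s≤s (∈-range1⁻ v∈)) 1+n<x) ∘ sym)))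

phi-snoc : ∀ {n w} v → Subexcedant n w → phi (w ∷ʳ v) ≡ map (swap (suc n) v) (phi w) ∷ʳ v
phi-snoc {n} {w} v sw = begin
  map (phiAt (w ∷ʳ v)) (range1 (length (w ∷ʳ v)))
    ≡⟨ cong (map (phiAt (w ∷ʳ v)) ∘ range1) (trans (length-∷ʳ w v) (cong suc (Subexcedant-length sw))) ⟩
  map (phiAt (w ∷ʳ v)) (range1 (suc n))
    ≡⟨ cong (map (phiAt (w ∷ʳ v))) (range1-suc n) ⟩
  map (phiAt (w ∷ʳ v)) (range1 n ∷ʳ suc n)
    ≡⟨ map-++ (phiAt (w ∷ʳ v)) (range1 n) [ suc n ] ⟩
  map (phiAt (w ∷ʳ v)) (range1 n) ∷ʳ phiAt (w ∷ʳ v) (suc n)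
    ≡⟨ cong₂ _∷ʳ_ (map-cong (phiAt-snoc v sw) (range1 n)) (phiAt-snoc v sw (suc n)) ⟩
  map (swap (suc n) v ∘ phiAt w) (range1 n) ∷ʳ swap (suc n) v (phiAt w (suc n))
    ≡⟨ cong₂ _∷ʳ_ (map-∘ (range1 n)) (cong (swap (suc n) v) (phiAt-fix sw (n<1+n n))) ⟩
  map (swap (suc n) v) (map (phiAt w) (range1 n)) ∷ʳ swap (suc n) v (suc n)
    ≡⟨ cong₂ _∷ʳ_ (cong (map (swap (suc n) v) ∘ map (phiAt w) ∘ range1) (sym (Subexcedant-length sw)))
                  (swap-≡ˡ (suc n) v) ⟩
  map (swap (suc n) v) (phi w) ∷ʳ v ∎
  where open ≡-Reasoning

phi-length : ∀ {n f} → Subexcedant n f → length (phi f) ≡ n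
phi-length {f = f} sf =
  trans (length-map (phiAt f) (range1 (length f)))
        (trans (length-range1 (length f)) (Subexcedant-length sf))

phi-entries : ∀ {n f} → Subexcedant n f → All (_∈ range1 n) (phi f)
phi-entries [] = []
phi-entries (snoc {n} {v = v} sw v∈) =
  subst (All (_∈ range1 (suc n))) (sym (phi-snoc v sw))
    (All.++⁺ (All.map⁺ (All.map (swap-preserves (suc n) v (_∈ range1 (suc n)) (top∈range1 n) v∈
                                  ∘ ∈-range1-suc⁺)
                                 (phi-entries sw)))
             (v∈ ∷ []))

phi-surjective : ∀ {n f y} → Subexcedant n f → y ∈ range1 n → y ∈ phi f
phi-surjective {y = y} (snoc {n} {v = v} sw v∈) y∈ with y ≟ v
... | yes refl = subst (y ∈_) (sym (phi-snoc v sw)) (∈-++⁺ʳ _ (here refl))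
... | no y≢v =
  subst (y ∈_) (sym (phi-snoc v sw))
    (∈-++⁺ˡ (subst (_∈ _) (swap-involutive (suc n) v y) (∈-map⁺ (swap (suc n) v) (phi-surjective sw y′∈))))
  where
  y′∈ : swap (suc n) v y ∈ range1 n
  y′∈ = ∈-range1-suc⁻ (swap-preserves (suc n) v (_∈ range1 (suc n)) (top∈range1 n) v∈ y∈)
          (λ y′≡top → y≢v (swap-injective (suc n) v (trans y′≡top (sym (swap-≡ʳ (suc n) v)))))

phi-injective : ∀ {n f f′} → Subexcedant n f → Subexcedant n f′ → phi f ≡ phi f′ → f ≡ f′
phi-injective [] [] _ = refl
phi-injective (snoc {n} {v = v} sw _) (snoc {v = v′} sw′ _) φf≡φf′
  with e , refl ← ∷ʳ-injective _ _ (trans (sym (phi-snoc v sw)) (trans φf≡φf′ (phi-snoc v′ sw′)))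
  = cong (_∷ʳ v) (phi-injective sw sw′ (map-injective (swap-injective (suc n) v) e))

eqWord⇒≡ : ∀ a b → T (eqWord a b) → a ≡ b
eqWord⇒≡ [] [] _ = refl
eqWord⇒≡ (x ∷ a) (y ∷ b) t =
  let x≡y , a≡b = T-∧⁻ t in cong₂ _∷_ (≡ᵇ⇒≡ x y x≡y) (eqWord⇒≡ a b a≡b)

eqWord-refl : ∀ a → T (eqWord a a)
eqWord-refl [] = _
eqWord-refl (x ∷ a) = T-∧⁺ (≡⇒≡ᵇ x x refl) (eqWord-refl a)

elemᵇ⁺ : ∀ {v w} → v ∈ w → T (elemᵇ v w)
elemᵇ⁺ v∈w = any⁺ _ (Any.map (λ v≡x → ≡⇒≡ᵇ _ _ (sym v≡x)) v∈w)

phi∈perms : ∀ {m f} → Subexcedant m f → phi f ∈ perms m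
phi∈perms {m} {f} sf =
  ∈-filterᵇ⁺ (isPermOf m) (subst (λ L → phi f ∈ words m L) (phi-length sf) (∈-words⁺ (phi-entries sf)))
    (All.all⁻ (λ v → elemᵇ v (phi f)) (All.tabulate (elemᵇ⁺ ∘ phi-surjective sf)))

fCatalan⁺ : ∀ m {f} → f ∈ subex m → T (isCatalan f) → T (fCatalan m (phi f))
fCatalan⁺ m {f} f∈ c = any⁺ _ (lose f∈ (T-∧⁺ (eqWord-refl (phi f)) c))

fCatalan⁻ : ∀ m π → T (fCatalan m π) → ∃ λ f → f ∈ subex m × phi f ≡ π × T (isCatalan f)
fCatalan⁻ m π t with f , f∈ , t′ ← find (any⁻ _ (subex m) t) =
  let φf≡π , c = T-∧⁻ t′ in f , f∈ , eqWord⇒≡ (phi f) π φf≡π , c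

-- Catalan words

isCatalan≡catalanTail0 : ∀ w → isCatalan w ≡ catalanTail 0 w
isCatalan≡catalanTail0 [] = refl
isCatalan≡catalanTail0 (0 ∷ w) = refl
isCatalan≡catalanTail0 (1 ∷ w) = refl
isCatalan≡catalanTail0 (suc (suc x) ∷ w) = refl

catalanTail-++-1∷ : ∀ h A ys → catalanTail h (A ++ 1 ∷ ys) ≡ catalanTail h A ∧ catalanTail 1 ys
catalanTail-++-1∷ h [] ys = refl
catalanTail-++-1∷ h (x ∷ A) ys =
  trans (cong (λ t → (1 ≤ᵇ x) ∧ ((x ≤ᵇ suc h) ∧ t)) (catalanTail-++-1∷ x A ys))
        (trans (cong ((1 ≤ᵇ x) ∧_) (sym (∧-assoc (x ≤ᵇ suc h) _ _))) (sym (∧-assoc (1 ≤ᵇ x) _ _)))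

catalanTail-map-suc : ∀ h ys → All (1 ≤_) ys → catalanTail (suc h) (map suc ys) ≡ catalanTail h ys
catalanTail-map-suc h [] [] = refl
catalanTail-map-suc h (suc y ∷ ys) (_ ∷ pys) = cong (_ ∧_) (catalanTail-map-suc (suc y) ys pys)

catalanTail-∷⁻ : ∀ {h x w} → T (catalanTail h (x ∷ w)) → 1 ≤ x × x ≤ suc h × T (catalanTail x w)
catalanTail-∷⁻ {h} {x} t =
  let 1≤x , t′ = T-∧⁻ t ; x≤1+h , tw = T-∧⁻ t′ in
  ≤ᵇ⇒≤ 1 x 1≤x , ≤ᵇ⇒≤ x (suc h) x≤1+h , tw

catalanTail-positive : ∀ h w → T (catalanTail h w) → All (1 ≤_) w
catalanTail-positive h [] _ = []
catalanTail-positive h (x ∷ w) t =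
  let 1≤x , _ , tw = catalanTail-∷⁻ {h} {x} {w} t in 1≤x ∷ catalanTail-positive x w tw

isCatalan-positive : ∀ {w} → T (isCatalan w) → All (1 ≤_) w
isCatalan-positive {w} c = catalanTail-positive 0 w (subst T (isCatalan≡catalanTail0 w) c)

catalanTail-subexcedant : ∀ {h p u} w → h ≤ p → Subexcedant p u → T (catalanTail h w) →
                          Subexcedant (p + length w) (u ++ w)
catalanTail-subexcedant {p = p} {u} [] _ su _ =
  subst₂ Subexcedant (sym (+-identityʳ p)) (sym (++-identityʳ u)) su
catalanTail-subexcedant {h} {p} {u} (x ∷ w) h≤p su t =
  let 1≤x , x≤1+h , tw = catalanTail-∷⁻ {h} {x} {w} t ; x≤1+p = ≤-trans x≤1+h (s≤s h≤p) in
  subst₂ Subexcedant (sym (+-suc p (length w))) (++-assoc u [ x ] w)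
    (catalanTail-subexcedant w x≤1+p (snoc su (∈-range1⁺ 1≤x x≤1+p)) tw)

isCatalan-subexcedant : ∀ {w} → T (isCatalan w) → Subexcedant (length w) w
isCatalan-subexcedant {w} c = catalanTail-subexcedant w z≤n [] (subst T (isCatalan≡catalanTail0 w) c)

isCatalan-map-suc : ∀ {B} → All (1 ≤_) B → T (isCatalan (map suc B)) → B ≡ []
isCatalan-map-suc [] _ = refl
isCatalan-map-suc (s≤s z≤n ∷ _) ()

data LastOne : List ℕ → Set where
  no-one   : ∀ B → All (1 ≤_) B → LastOne (map suc B)
  last-one : ∀ A B → All (1 ≤_) B → LastOne (A ++ 1 ∷ map suc B)

lastOne : ∀ w → All (1 ≤_) w → LastOne w
lastOne [] [] = no-one [] []
lastOne (x ∷ w) (1≤x ∷ pw) with lastOne w pw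
... | last-one A B pB = last-one (x ∷ A) B pB
... | no-one B pB = prepend x 1≤x
  where
  prepend : ∀ x → 1 ≤ x → LastOne (x ∷ map suc B)
  prepend 1 _ = last-one [] B pB
  prepend (suc (suc y)) _ = no-one (suc y ∷ B) (s≤s z≤n ∷ pB)

catalanJoin : List ℕ × List ℕ → List ℕ
catalanJoin (A , B) = A ++ 1 ∷ map suc B

length-catalanJoin : ∀ A B → length (catalanJoin (A , B)) ≡ suc (length A + length B)
length-catalanJoin A B =
  trans (length-++-sucʳ A 1 (map suc B))
        (cong suc (trans (length-++ A) (cong (length A +_) (length-map suc B))))

1∉map-suc : ∀ {B} → All (1 ≤_) B → 1 ∉ map suc B
1∉map-suc pB 1∈ with _ , b∈ , refl ← ∈-map⁻ suc 1∈ = contradiction (All.lookup pB b∈) λ ()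

catalanJoin-injective : ∀ {A A′ B B′} → All (1 ≤_) B → All (1 ≤_) B′ →
                        catalanJoin (A , B) ≡ catalanJoin (A′ , B′) → (A , B) ≡ (A′ , B′)
catalanJoin-injective {A} pB pB′ e with refl , e′ ← ++-∷-cancel A _ (1∉map-suc pB) (1∉map-suc pB′) e =
  cong (A ,_) (map-injective suc-injective e′)

isCatalan-join : ∀ A {B} → All (1 ≤_) B → isCatalan (catalanJoin (A , B)) ≡ isCatalan A ∧ isCatalan B
isCatalan-join A {B} pB = begin
  isCatalan (A ++ 1 ∷ map suc B)
    ≡⟨ isCatalan≡catalanTail0 (A ++ 1 ∷ map suc B) ⟩
  catalanTail 0 (A ++ 1 ∷ map suc B)
    ≡⟨ catalanTail-++-1∷ 0 A (map suc B) ⟩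
  catalanTail 0 A ∧ catalanTail 1 (map suc B)
    ≡⟨ cong (_ ∧_) (catalanTail-map-suc 0 B pB) ⟩
  catalanTail 0 A ∧ catalanTail 0 B
    ≡⟨ sym (cong₂ _∧_ (isCatalan≡catalanTail0 A) (isCatalan≡catalanTail0 B)) ⟩
  isCatalan A ∧ isCatalan B ∎
  where open ≡-Reasoning

-- Mod-k-alternating Catalan words

%-cong-+ˡ : ∀ d .{{_ : NonZero d}} c {a b} → a % d ≡ b % d → (c + a) % d ≡ (c + b) % d
%-cong-+ˡ d c {a} {b} a≡b =
  trans (%-distribˡ-+ c a d) (trans (cong (λ r → (c % d + r) % d) a≡b) (sym (%-distribˡ-+ c b d)))

%-suc-injective : ∀ d .{{_ : NonZero d}} {a b} → suc a % d ≡ suc b % d → a % d ≡ b % d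
%-suc-injective (suc d) {a} {b} e = begin
  a % suc d           ≡⟨ sym ([m+n]%n≡m%n a (suc d)) ⟩
  (a + suc d) % suc d ≡⟨ cong (_% suc d) (trans (+-comm a (suc d)) (sym (+-suc d a))) ⟩
  (d + suc a) % suc d ≡⟨ %-cong-+ˡ (suc d) d e ⟩
  (d + suc b) % suc d ≡⟨ cong (_% suc d) (trans (+-suc d b) (+-comm (suc d) b)) ⟩
  (b + suc d) % suc d ≡⟨ [m+n]%n≡m%n b (suc d) ⟩
  b % suc d           ∎
  where open ≡-Reasoning

module _ (k : ℕ) .{{_ : NonZero k}} where

  ≡ᵇ-%-suc : ∀ a b → (suc a % k ≡ᵇ suc b % k) ≡ (a % k ≡ᵇ b % k)
  ≡ᵇ-%-suc a b = does-⇔ (mk⇔ (%-suc-injective k) (%-cong-+ˡ k 1)) (_ ≟ _) (_ ≟ _)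

  ≡ᵇ-%-1 : ∀ j → (1 % k ≡ᵇ suc j % k) ≡ ⌊ k ∣? j ⌋
  ≡ᵇ-%-1 j = trans (does-⇔ (mk⇔ to from) (_ ≟ _) (k ∣? j)) (sym (isYes≗does (k ∣? j)))
    where
    to : 1 % k ≡ suc j % k → k ∣ j
    to e = m%n≡0⇒n∣m j k (trans (sym (%-suc-injective k e)) (n∣m⇒m%n≡0 0 k (k ∣0)))
    from : k ∣ j → 1 % k ≡ suc j % k
    from k∣j = sym (%-remove-+ʳ 1 k∣j)

  modAltAux-++ : ∀ i xs ys → modAltAux k i (xs ++ ys) ≡ modAltAux k i xs ∧ modAltAux k (i + length xs) ys
  modAltAux-++ i [] ys = cong (λ j → modAltAux k j ys) (sym (+-identityʳ i))
  modAltAux-++ i (x ∷ xs) ys =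
    trans (cong ((x % k ≡ᵇ i % k) ∧_)
                (trans (modAltAux-++ (suc i) xs ys)
                       (cong (λ j → modAltAux k (suc i) xs ∧ modAltAux k j ys)
                             (sym (+-suc i (length xs))))))
          (sym (∧-assoc (x % k ≡ᵇ i % k) (modAltAux k (suc i) xs) _))

  modAltAux-shift : ∀ {i j} ys → i % k ≡ j % k → modAltAux k i ys ≡ modAltAux k j ys
  modAltAux-shift [] _ = refl
  modAltAux-shift (y ∷ ys) i≡j = cong₂ _∧_ (cong (y % k ≡ᵇ_) i≡j) (modAltAux-shift ys (%-cong-+ˡ k 1 i≡j))

  modAltAux-map-suc : ∀ i ys → modAltAux k (suc i) (map suc ys) ≡ modAltAux k i ys
  modAltAux-map-suc i [] = refl
  modAltAux-map-suc i (y ∷ ys) = cong₂ _∧_ (≡ᵇ-%-suc y i) (modAltAux-map-suc (suc i) ys)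

  modAltAux-map-swap : ∀ {a b} → a % k ≡ b % k →
                       ∀ i ys → modAltAux k i (map (swap a b) ys) ≡ modAltAux k i ys
  modAltAux-map-swap a≡b i [] = refl
  modAltAux-map-swap {a} {b} a≡b i (y ∷ ys) =
    cong₂ _∧_ (cong (_≡ᵇ i % k) (swap-% a b k a≡b y)) (modAltAux-map-swap a≡b (suc i) ys)

  isModAlt-snoc : ∀ {n} xs v → length xs ≡ n →
                  isModAlt k (xs ∷ʳ v) ≡ (v % k ≡ᵇ suc n % k) ∧ isModAlt k xs
  isModAlt-snoc xs v refl = begin
    modAltAux k 1 (xs ++ [ v ])                              ≡⟨ modAltAux-++ 1 xs [ v ] ⟩
    isModAlt k xs ∧ ((v % k ≡ᵇ suc (length xs) % k) ∧ true) ≡⟨ ∧-comm (isModAlt k xs) _ ⟩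
    ((v % k ≡ᵇ suc (length xs) % k) ∧ true) ∧ isModAlt k xs ≡⟨ cong (_∧ isModAlt k xs) (∧-identityʳ _) ⟩
    (v % k ≡ᵇ suc (length xs) % k) ∧ isModAlt k xs          ∎
    where open ≡-Reasoning

  isModAlt-join : ∀ A B →
    isModAlt k (catalanJoin (A , B)) ≡ isModAlt k A ∧ (⌊ k ∣? length A ⌋ ∧ isModAlt k B)
  isModAlt-join A B = trans (modAltAux-++ 1 A (1 ∷ map suc B)) (cong (isModAlt k A ∧_) (begin
    (1 % k ≡ᵇ suc (length A) % k) ∧ modAltAux k (suc (suc (length A))) (map suc B)
      ≡⟨ cong (_ ∧_) (modAltAux-map-suc _ B) ⟩
    (1 % k ≡ᵇ suc (length A) % k) ∧ modAltAux k (suc (length A)) B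
      ≡⟨ ∧-congˡ-guarded _ (λ t → modAltAux-shift B (sym (≡ᵇ⇒≡ _ _ t))) ⟩
    (1 % k ≡ᵇ suc (length A) % k) ∧ isModAlt k B
      ≡⟨ cong (_∧ isModAlt k B) (≡ᵇ-%-1 (length A)) ⟩
    ⌊ k ∣? length A ⌋ ∧ isModAlt k B ∎))
    where open ≡-Reasoning

  phi-isModAlt : ∀ {n f} → Subexcedant n f → isModAlt k (phi f) ≡ isModAlt k f
  phi-isModAlt [] = refl
  phi-isModAlt (snoc {n} {w} {v} sw _) = begin
    isModAlt k (phi (w ∷ʳ v))
      ≡⟨ cong (isModAlt k) (phi-snoc v sw) ⟩
    isModAlt k (map (swap (suc n) v) (phi w) ∷ʳ v)
      ≡⟨ isModAlt-snoc (map (swap (suc n) v) (phi w)) v (trans (length-map _ (phi w)) (phi-length sw)) ⟩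
    (v % k ≡ᵇ suc n % k) ∧ isModAlt k (map (swap (suc n) v) (phi w))
      ≡⟨ ∧-congˡ-guarded _ (λ t → trans (modAltAux-map-swap (sym (≡ᵇ⇒≡ _ _ t)) 1 (phi w))
                                         (phi-isModAlt sw)) ⟩
    (v % k ≡ᵇ suc n % k) ∧ isModAlt k w
      ≡⟨ sym (isModAlt-snoc w v (Subexcedant-length sw)) ⟩
    isModAlt k (w ∷ʳ v) ∎
    where open ≡-Reasoning

  isAltCatalan : List ℕ → Bool
  isAltCatalan w = isCatalan w ∧ isModAlt k w

  altCatalan : ℕ → List (List ℕ)
  altCatalan n = filterᵇ isAltCatalan (subex n)

  altCatalan-unique : ∀ n → Unique (altCatalan n)
  altCatalan-unique n = filterᵇ-unique isAltCatalan (subex-unique n)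

  ∈-altCatalan⁺ : ∀ w → T (isAltCatalan w) → w ∈ altCatalan (length w)
  ∈-altCatalan⁺ w t = ∈-filterᵇ⁺ isAltCatalan (∈-subex⁺ (isCatalan-subexcedant (proj₁ (T-∧⁻ t)))) t

  ∈-altCatalan⁻ : ∀ n {w} → w ∈ altCatalan n → T (isAltCatalan w) × Subexcedant n w
  ∈-altCatalan⁻ n w∈ = let w∈subex , t = ∈-filterᵇ⁻ isAltCatalan w∈ in t , ∈-subex⁻ n w∈subex

  isAltCatalan-positive : ∀ w → T (isAltCatalan w) → All (1 ≤_) w
  isAltCatalan-positive w = isCatalan-positive ∘ proj₁ ∘ T-∧⁻

  isAltCatalan-join : ∀ A {B} → All (1 ≤_) B →
    isAltCatalan (catalanJoin (A , B)) ≡ isAltCatalan A ∧ (⌊ k ∣? length A ⌋ ∧ isAltCatalan B)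
  isAltCatalan-join A {B} pB =
    trans (cong₂ _∧_ (isCatalan-join A pB) (isModAlt-join A B))
          (trans (interchange (isCatalan A) (isCatalan B) (isModAlt k A) _)
                 (cong (isAltCatalan A ∧_) (x∙yz≈y∙xz (isCatalan B) ⌊ k ∣? length A ⌋ (isModAlt k B))))

  isAltCatalan-join⁺ : ∀ A B → T (isAltCatalan A) → k ∣ length A → T (isAltCatalan B) →
                       T (isAltCatalan (catalanJoin (A , B)))
  isAltCatalan-join⁺ A B tA k∣A tB =
    subst T (sym (isAltCatalan-join A (isAltCatalan-positive B tB)))
      (T-∧⁺ tA (T-∧⁺ (fromWitness {a? = k ∣? length A} k∣A) tB))

  isAltCatalan-join⁻ : ∀ A B → All (1 ≤_) B → T (isAltCatalan (catalanJoin (A , B))) →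
                       T (isAltCatalan A) × k ∣ length A × T (isAltCatalan B)
  isAltCatalan-join⁻ A B pB t =
    let tA , t′ = T-∧⁻ (subst T (isAltCatalan-join A pB) t) ; k∣A , tB = T-∧⁻ {⌊ k ∣? length A ⌋} t′ in
    tA , toWitness k∣A , tB

  mpC≡length-altCatalan : ∀ m → mpC m k ≡ length (altCatalan m)
  mpC≡length-altCatalan m =
    trans (length-unique-⇔ (filterᵇ-unique _ (filterᵇ-unique _ (words-unique m m)))
                           (map⁺-injectiveOn injective (altCatalan-unique m))
                           (mk⇔ to from))
          (length-map phi (altCatalan m))
    where
    P : List ℕ → Bool
    P π = isModAlt k π ∧ fCatalan m π

    injective : ∀ {f f′} → f ∈ altCatalan m → f′ ∈ altCatalan m → phi f ≡ phi f′ → f ≡ f′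
    injective f∈ f′∈ = phi-injective (proj₂ (∈-altCatalan⁻ m f∈)) (proj₂ (∈-altCatalan⁻ m f′∈))

    to : ∀ {π} → π ∈ filterᵇ P (perms m) → π ∈ map phi (altCatalan m)
    to {π} π∈ with a , c ← T-∧⁻ {isModAlt k π} (proj₂ (∈-filterᵇ⁻ P {xs = perms m} π∈))
              with f , f∈ , refl , isCat ← fCatalan⁻ m π c =
      ∈-map⁺ phi (∈-filterᵇ⁺ isAltCatalan f∈
                    (T-∧⁺ isCat (subst T (phi-isModAlt (∈-subex⁻ m f∈)) a)))

    from : ∀ {π} → π ∈ map phi (altCatalan m) → π ∈ filterᵇ P (perms m)
    from π∈ with f , f∈ , refl ← ∈-map⁻ phi π∈ =
      let f∈subex , t = ∈-filterᵇ⁻ isAltCatalan {xs = subex m} f∈ ; isCat , a = T-∧⁻ t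
          sf = ∈-subex⁻ m f∈subex in
      ∈-filterᵇ⁺ P (phi∈perms sf)
        (T-∧⁺ (subst T (sym (phi-isModAlt sf)) a) (fCatalan⁺ m f∈subex isCat))

  r≡length-altCatalan : ∀ n → r k n ≡ length (altCatalan n)
  r≡length-altCatalan zero    = refl
  r≡length-altCatalan (suc n) = mpC≡length-altCatalan (suc n)

  module _ (n : ℕ) where

    multiplesOfK : List ℕ
    multiplesOfK = filterᵇ (λ j → ⌊ k ∣? j ⌋) (upTo (suc n))

    ∈-multiplesOfK⁺ : ∀ {j} → j ≤ n → k ∣ j → j ∈ multiplesOfK
    ∈-multiplesOfK⁺ j≤n k∣j = ∈-filterᵇ⁺ (λ j → ⌊ k ∣? j ⌋) (∈-upTo⁺ (s≤s j≤n)) (fromWitness k∣j)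

    ∈-multiplesOfK⁻ : ∀ {j} → j ∈ multiplesOfK → j ≤ n × k ∣ j
    ∈-multiplesOfK⁻ j∈ =
      let j∈upTo , k∣j = ∈-filterᵇ⁻ (λ j → ⌊ k ∣? j ⌋) j∈ in ≤-pred (∈-upTo⁻ j∈upTo) , toWitness k∣j

    pairs : ℕ → List (List ℕ × List ℕ)
    pairs j = cartesianProduct (altCatalan j) (altCatalan (n ∸ j))

    splittings : List (List ℕ × List ℕ)
    splittings = concatMap pairs multiplesOfK

    ∈-splittings⁺ : ∀ {j A B} → j ∈ multiplesOfK → A ∈ altCatalan j → B ∈ altCatalan (n ∸ j) →
                    (A , B) ∈ splittings
    ∈-splittings⁺ j∈ A∈ B∈ = ∈-concatMap⁺ pairs (lose j∈ (∈-cartesianProduct⁺ A∈ B∈))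

    ∈-splittings⁻ : ∀ {A B} → (A , B) ∈ splittings →
                    ∃ λ j → j ∈ multiplesOfK × A ∈ altCatalan j × B ∈ altCatalan (n ∸ j)
    ∈-splittings⁻ p∈ with j , j∈ , p∈pairs ← find (∈-concatMap⁻ pairs {multiplesOfK} p∈) =
      j , j∈ , ∈-cartesianProduct⁻ (altCatalan j) (altCatalan (n ∸ j)) p∈pairs

    splittings-unique : Unique splittings
    splittings-unique =
      concatMap⁺-fibres (length ∘ proj₁) fibre
        (λ j → cartesianProduct⁺ (altCatalan-unique j) (altCatalan-unique (n ∸ j)))
        (filterᵇ-unique (λ j → ⌊ k ∣? j ⌋) (upTo⁺ (suc n)))
      where
      fibre : ∀ {j p} → p ∈ pairs j → length (proj₁ p) ≡ j
      fibre {j} p∈ =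
        let A∈ , _ = ∈-cartesianProduct⁻ (altCatalan j) (altCatalan (n ∸ j)) p∈ in
        Subexcedant-length (proj₂ (∈-altCatalan⁻ j A∈))

    catalanJoin-injectiveOn : ∀ {p q} → p ∈ splittings → q ∈ splittings →
                              catalanJoin p ≡ catalanJoin q → p ≡ q
    catalanJoin-injectiveOn {_ , _} {_ , _} p∈ q∈ = catalanJoin-injective (positive p∈) (positive q∈)
      where
      positive : ∀ {A B} → (A , B) ∈ splittings → All (1 ≤_) B
      positive {B = B} p∈ with j , _ , _ , B∈ ← ∈-splittings⁻ p∈ =
        isAltCatalan-positive B (proj₁ (∈-altCatalan⁻ (n ∸ j) B∈))

    split : ∀ {w} → w ∈ altCatalan (suc n) → w ∈ map catalanJoin splittings
    split {w} w∈ with t , sw ← ∈-altCatalan⁻ (suc n) w∈ with lastOne w (isAltCatalan-positive w t)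
    ... | no-one B pB with refl ← isCatalan-map-suc pB (proj₁ (T-∧⁻ t)) =
      contradiction (Subexcedant-length sw) λ ()
    ... | last-one A B pB with tA , k∣A , tB ← isAltCatalan-join⁻ A B pB t =
      ∈-map⁺ catalanJoin (∈-splittings⁺ (∈-multiplesOfK⁺ |A|≤n k∣A) (∈-altCatalan⁺ A tA)
                                        (subst (λ L → B ∈ altCatalan L) |B|≡n∸|A| (∈-altCatalan⁺ B tB)))
      where
      |A|+|B|≡n : length A + length B ≡ n
      |A|+|B|≡n = suc-injective (trans (sym (length-catalanJoin A B)) (Subexcedant-length sw))
      |A|≤n : length A ≤ n
      |A|≤n = subst (length A ≤_) |A|+|B|≡n (m≤m+n (length A) (length B))
      |B|≡n∸|A| : length B ≡ n ∸ length A
      |B|≡n∸|A| = trans (sym (m+n∸m≡n (length A) (length B))) (cong (_∸ length A) |A|+|B|≡n)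

    join : ∀ {w} → w ∈ map catalanJoin splittings → w ∈ altCatalan (suc n)
    join w∈ with (A , B) , p∈ , refl ← ∈-map⁻ catalanJoin w∈
            with j , j∈ , A∈ , B∈ ← ∈-splittings⁻ p∈
            with tA , sA ← ∈-altCatalan⁻ j A∈
            with tB , sB ← ∈-altCatalan⁻ (n ∸ j) B∈
            with j≤n , k∣j ← ∈-multiplesOfK⁻ j∈ =
      subst (λ L → catalanJoin (A , B) ∈ altCatalan L) length≡
        (∈-altCatalan⁺ (catalanJoin (A , B))
          (isAltCatalan-join⁺ A B tA (subst (k ∣_) (sym (Subexcedant-length sA)) k∣j) tB))
      where
      length≡ : length (catalanJoin (A , B)) ≡ suc n
      length≡ = trans (length-catalanJoin A B)
                      (cong suc (trans (cong₂ _+_ (Subexcedant-length sA) (Subexcedant-length sB))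
                                       (m+[n∸m]≡n j≤n)))

    length-altCatalan-suc : length (altCatalan (suc n)) ≡
                            sum (map (λ j → length (altCatalan j) * length (altCatalan (n ∸ j))) multiplesOfK)
    length-altCatalan-suc = begin
      length (altCatalan (suc n))
        ≡⟨ length-unique-⇔ (altCatalan-unique (suc n))
                           (map⁺-injectiveOn catalanJoin-injectiveOn splittings-unique)
                           (mk⇔ split join) ⟩
      length (map catalanJoin splittings)
        ≡⟨ length-map catalanJoin splittings ⟩
      length splittings
        ≡⟨ length-concatMap pairs multiplesOfK ⟩
      sum (map (length ∘ pairs) multiplesOfK)
        ≡⟨ cong sum (map-cong (λ j → length-cartesianProduct (altCatalan j) (altCatalan (n ∸ j)))
                              multiplesOfK) ⟩
      sum (map (λ j → length (altCatalan j) * length (altCatalan (n ∸ j))) multiplesOfK) ∎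
      where open ≡-Reasoning

mainTheorem9 : (k : ℕ) → .{{_ : NonZero k}} → (n : ℕ) →
    r k (suc n) ≡ convSum k n
mainTheorem9 k n = begin
  r k (suc n)
    ≡⟨ r≡length-altCatalan k (suc n) ⟩
  length (altCatalan k (suc n))
    ≡⟨ length-altCatalan-suc k n ⟩
  sum (map (λ j → length (altCatalan k j) * length (altCatalan k (n ∸ j))) (multiplesOfK k n))
    ≡⟨ cong sum (map-cong (λ j → sym (cong₂ _*_ (r≡length-altCatalan k j) (r≡length-altCatalan k (n ∸ j))))
                          (multiplesOfK k n)) ⟩
  convSum k n ∎
  where open ≡-Reasoning
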